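{- Let $G=(V,E)$ be a graph satisfying the standing assumptions, and let $\bar G=(\bar V,\bar E)$ be the derived graph defined below. Let $u,v\in V$ with $\tau(u)=\tau(v)=3$. Then: (1) if $\min_u=\min_v$, then $\min_{\bar u}=\min_{\bar v}$ (minima computed in $\bar G$); (2) if $\min_u\prec\min_v$, then $\min_{\bar u}\prec'\min_{\bar v}$.
   Context: Standing assumptions: $\Sigma$ is a finite alphabet with a total order $\preceq$; $G=(V,E)$ is finite, $E\subseteq V\times V\times\Sigma$, every character labels some edge, every node has an incoming edge, all edges entering a node $u$ have the same label $\lambda(u)$ (edges are written $(u,v)$), and $G$ is deterministic (for each $u$ and $a$ at most one $v$ with $(u,v)\in E$, $\lambda(v)=a$). Strings in $\Sigma^\omega$ (right-infinite) are ordered lexicographically; for a string $\alpha$, $\alpha[i]$ is its $i$-th character and $\alpha[i,j]=\alpha[i]\cdots\alpha[j]$ (empty if $j<i$). An occurrence of $\alpha\in\Sigma^\omega$ starting at $u$ is a sequence $(u_i)_{i\ge1}$ with $u_1=u$, $(u_{i+1},u_i)\in E$, $\lambda(u_i)=\alpha[i]$. $I_u$ is the set of strings with an occurrence starting at $u$, and $\min_u$ its lexicographic minimum. For $\alpha=a\alpha'\in\Sigma^\omega$ ($a\in\Sigma$): $\tau(\alpha)=1$ if $\alpha'\prec\alpha$, $=2$ if $\alpha'=\alpha$, $=3$ if $\alpha\prec\alpha'$; $\tau(u):=\tau(\min_u)$. For $u$ with $\tau(u)=3$, $\ell_u$ is the smallest $k\ge2$ with $\tau(u_k)\ge2$, where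 $(u_i)$ is any occurrence of $\min_u$ starting at $u$ (this does not depend on the occurrence). For nonempty $R\subseteq V$, let $R'=\arg\min_{v\in R}\lambda(v)$ and $\mathtt{F}(R)=\arg\min_{v\in R'}\tau(v)$. Define $G_1(u)=\{u\}$ and for $1<i\le\ell_u$, $G_i(u)=\mathtt{F}(\{v'\in V: \exists v\in G_{i-1}(u), (v',v)\in E\})\setminus\bigcup_{j=2}^{i-1}G_j(u)$. All nodes of $G_i(u)$ share the same $\tau$ value, denoted $\tau(G_i(u))$. Put $\gamma_u=\min_u[1,\ell_u]$ and $\mathtt{t}_u=\tau(G_{\ell_u}(u))\in\{2,3\}$. Let $\Sigma'=\{(\gamma_u,\mathtt{t}_u): u\in V,\tau(u)=3\}$ with the total order $\preceq'$ where for distinct $(\alpha,x),(\beta,y)$: $(\alpha,x)\prec'(\beta,y)$ iff either $\alpha$ is not a prefix of $\beta$ and $\alpha\prec\beta$; or $\alpha=\beta$, $x=2$, $y=3$; or $\beta$ is a strict prefix of $\alpha$. The derived graph $\bar G$ has nodes $\bar V=\{\bar u: u\in V,\tau(u)=3\}$, alphabet $(\Sigma',\preceq')$, labels $\lambda(\bar u)=(\gamma_u,\mathtt{t}_u)$ and edges $\bar E=\{(\bar v,\bar v):\mathtt{t}_v=2\}\cup\{(\bar u,\bar v):\mathtt{t}_v=3,\ u\in G_{\ell_v}(v)\}$; minima in $\bar G$ are taken w.r.t. the lexicographic extension of $\preceq'$ to $(\Sigma')^\omega$. -}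

module Defs where

open import Data.Nat using (ℕ; zero; suc; _≤_; _<_; _∸_)
open import Data.Fin using (Fin) renaming (_≤_ to _≤ᶠ_; _<_ to _<ᶠ_)
open import Data.List using (List; []; _∷_; _++_; map; upTo)
open import Data.Product using (Σ; ∃; ∃-syntax; _×_; _,_; proj₁)
open import Data.Sum using (_⊎_)
open import Data.Empty using (⊥)
open import Relation.Nullary using (¬_; Dec)
open import Relation.Binary.PropositionalEquality using (_≡_; _≢_)

-- Generic notions for a node-labelled graph over an ordered alphabet.
-- Strings in Σ^ω are functions ℕ → A, 0-indexed: α i is the paper's α[i+1].

StrEq : {A : Set} → (ℕ → A) → (ℕ → A) → Set
StrEq α β = ∀ i → α i ≡ β i

LexLess : {A : Set} → (A → A → Set) → (ℕ → A) → (ℕ → A) → Set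
LexLess _<ₐ_ α β = ∃[ k ] ((∀ i → i < k → α i ≡ β i) × (α k <ₐ β k))

-- s is an occurrence of α starting at u (s i is the paper's u_{i+1}):
-- Edge x y means (x , y) is an edge.
Occurrence : {V A : Set} → (V → A) → (V → V → Set) →
             V → (ℕ → A) → (ℕ → V) → Set
Occurrence lab Edge u α s =
  (s 0 ≡ u) × (∀ i → Edge (s (suc i)) (s i)) × (∀ i → lab (s i) ≡ α i)

InI : {V A : Set} → (V → A) → (V → V → Set) → V → (ℕ → A) → Set
InI {V} lab Edge u α = Σ (ℕ → V) (Occurrence lab Edge u α)

IsMinAt : {V A : Set} → (A → A → Set) → (V → A) → (V → V → Set) →
          V → (ℕ → A) → Set
IsMinAt _<ₐ_ lab Edge u α =
  InI lab Edge u α × (∀ β → InI lab Edge u β → StrEq α β ⊎ LexLess _<ₐ_ α β)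

tail : {A : Set} → (ℕ → A) → (ℕ → A)
tail α i = α (suc i)

data TauIs {A : Set} (_<ₐ_ : A → A → Set) (α : ℕ → A) : ℕ → Set where
  tau1 : LexLess _<ₐ_ (tail α) α → TauIs _<ₐ_ α 1
  tau2 : StrEq (tail α) α → TauIs _<ₐ_ α 2
  tau3 : LexLess _<ₐ_ α (tail α) → TauIs _<ₐ_ α 3

-- The input graph: V = Fin n, Σ = Fin k with its standard (total) order.
-- E u v : the edge (u , v) is present; its label is lab v = λ(v).

IsGraph : (n k : ℕ) → (Fin n → Fin k) → (Fin n → Fin n → Set) → Set
IsGraph n k lab E =
  (∀ u v → Dec (E u v))                                   -- E is a finite (decidable) set
  × (∀ (a : Fin k) → ∃[ u ] ∃[ v ] (E u v × lab v ≡ a))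
  × (∀ v → ∃[ u ] E u v)
  × (∀ u v w → E u v → E u w → lab v ≡ lab w → v ≡ w)

Prefix : {A : Set} → List A → List A → Set
Prefix α β = ∃[ γ ] (α ++ γ ≡ β)

StrictPrefix : {A : Set} → List A → List A → Set
StrictPrefix α β = ∃[ γ ] ((γ ≢ []) × (α ++ γ ≡ β))

ListLex : {A : Set} → (A → A → Set) → List A → List A → Set
ListLex {A} _<ₐ_ α β =
  StrictPrefix α β
  ⊎ (Σ (List A) λ p → Σ A λ c → Σ A λ d → Σ (List A) λ r₁ → Σ (List A) λ r₂ →
       (α ≡ p ++ (c ∷ r₁)) × (β ≡ p ++ (d ∷ r₂)) × (c <ₐ d))

Σ' : ℕ → Set
Σ' k = List (Fin k) × ℕ

_≺'_ : {k : ℕ} → Σ' k → Σ' k → Set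
(α , x) ≺' (β , y) =
  ((α , x) ≢ (β , y)) ×
  (((¬ Prefix α β) × ListLex _<ᶠ_ α β)
   ⊎ ((α ≡ β) × (x ≡ 2) × (y ≡ 3))
   ⊎ StrictPrefix β α)

-- The construction, relative to the graph (lab , E) and
--   mn  : the minima min_u,   τf : τ(u) = τ(min_u),
--   ℓ   : ℓ_u,                tt : t_u.

module Construction {n k : ℕ} (lab : Fin n → Fin k) (E : Fin n → Fin n → Set)
                    (τf : Fin n → ℕ) where

  InR' : (Fin n → Set) → Fin n → Set
  InR' R w = R w × (∀ x → R x → lab w ≤ᶠ lab x)

  F : (Fin n → Set) → Fin n → Set
  F R w = InR' R w × (∀ x → InR' R x → τf w ≤ τf x)

  Pred : (Fin n → Set) → Fin n → Set
  Pred R w = ∃[ v ] (R v × E w v)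

  -- Gset u i = G_i(u) (1-indexed; index 0 unused);
  -- Uset u i = ⋃_{j=2}^{i} G_j(u)
  mutual
    Gset : Fin n → ℕ → Fin n → Set
    Gset u zero w = ⊥
    Gset u (suc zero) w = w ≡ u
    Gset u (suc (suc i)) w = F (Pred (Gset u (suc i))) w × ¬ Uset u (suc i) w

    Uset : Fin n → ℕ → Fin n → Set
    Uset u zero w = ⊥
    Uset u (suc zero) w = ⊥
    Uset u (suc (suc i)) w = Uset u (suc i) w ⊎ Gset u (suc (suc i)) w

  -- L = ℓ_u, witnessed on an occurrence s of min_u (u_j = s (j ∸ 1))
  EllSpec : (Fin n → ℕ → Fin k) → Fin n → ℕ → Set
  EllSpec mn u L =
    ∃[ s ] (Occurrence lab E u (mn u) s
            × (2 ≤ L)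
            × (2 ≤ τf (s (L ∸ 1)))
            × (∀ j → 2 ≤ j → j < L → τf (s (j ∸ 1)) < 2))

  TSpec : (ℓ : Fin n → ℕ) → Fin n → ℕ → Set
  TSpec ℓ u t = ∃[ w ] (Gset u (ℓ u) w × τf w ≡ t)

  module Derived (mn : Fin n → ℕ → Fin k) (ℓ : Fin n → ℕ) (tt : Fin n → ℕ) where

    γ : Fin n → List (Fin k)
    γ u = map (mn u) (upTo (ℓ u))

    V̄ : Set
    V̄ = Σ (Fin n) λ u → τf u ≡ 3

    lab̄ : V̄ → Σ' k
    lab̄ (u , _) = (γ u , tt u)

    Ē : V̄ → V̄ → Set
    Ē (u , _) (v , _) = ((tt v ≡ 2) × (u ≡ v)) ⊎ ((tt v ≡ 3) × Gset v (ℓ v) u)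

{-# OPTIONS --safe #-}

-- Write α = min_u and a = ℓ_u − 1.  Taking predecessors of least label, then least type,
-- starting from u retraces α: every node of G_{ℓ_u}(u) spells a string at least α[a..], and
-- some node u⁺ spells exactly α[a..].  Hence the minimum of ū in the derived graph is the
-- label sequence of the path ū, ū⁺, ū⁺⁺, … (which stays at ū once t_u = 2), and it depends
-- on α alone: its first letter (α[0..a], t_u) is read off α and its tail is the same
-- construction for α[a..].  To compare the sequences of u and v, induct on the first
-- difference of min_u and min_v: it falls inside both first blocks, or one block is a proper
-- prefix of the other, or the blocks coincide (the descent pattern of τ forces equal
-- lengths) and the comparison passes to the suffixes, on which τ is monotone.

module Submission where

open import Defs
open import Data.Nat using (ℕ; zero; suc; _+_; _∸_; _≤_; _<_; z≤n; s≤s; _<?_; _≟_)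
open import Data.Nat.Properties
  using (≤-refl; ≤-reflexive; ≤-trans; ≤-antisym; ≤-pred; <-irrefl; <-asym; <-trans; <-≤-trans;
         <⇒≤; ≮⇒≥; <-cmp; n≤1+n; m≤n⇒m<n∨m≡n; m<n⇒m<1+n; m≤m+n; m<m+n; m<n+m; +-suc; +-assoc;
         +-identityʳ; +-monoʳ-≤; +-monoʳ-<; m+[n∸m]≡n; m≤n⇒∃[o]m+o≡n; ≡-irrelevant;
         module ≤-Reasoning)
open import Data.Nat.Induction using (<-rec)
open import Data.Fin using (Fin) renaming (_<_ to _<ᶠ_; _≤_ to _≤ᶠ_)
import Data.Fin.Properties as Fin
open import Data.List using (List; []; _∷_; _++_; length; map; upTo; applyUpTo)
open import Data.List.Properties
  using (∷-injectiveˡ; ∷-injectiveʳ; ++-cancelˡ; ++-assoc; ++-identityʳ; length-++; map-upTo)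
open import Data.Product using (Σ; ∃-syntax; _×_; _,_; proj₁; proj₂)
open import Data.Sum using (_⊎_; inj₁; inj₂)
open import Data.Empty using (⊥; ⊥-elim)
open import Relation.Nullary using (¬_; yes; no)
open import Relation.Binary.Structures using (IsStrictTotalOrder)
open import Relation.Binary.Definitions
  using (Irreflexive; Asymmetric; Transitive; Tri; tri<; tri≈; tri>)
open import Relation.Binary.PropositionalEquality
  using (_≡_; _≢_; refl; sym; trans; cong; cong₂; subst; subst₂; module ≡-Reasoning)

Stream : Set → Set
Stream A = ℕ → A

infix 4 _≐_

_≐_ : {A : Set} → Stream A → Stream A → Set
_≐_ = StrEq

shift : {A : Set} → ℕ → Stream A → Stream A
shift j x i = x (j + i)

infixr 5 _∷ˢ_

_∷ˢ_ : {A : Set} → A → Stream A → Stream A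
(a ∷ˢ x) zero = a
(a ∷ˢ x) (suc i) = x i

Agree : {A : Set} → ℕ → Stream A → Stream A → Set
Agree K x y = ∀ i → i < K → x i ≡ y i

module _ {A : Set} where

  ≐-refl : {x : Stream A} → x ≐ x
  ≐-refl i = refl

  ≐-sym : {x y : Stream A} → x ≐ y → y ≐ x
  ≐-sym x≐y i = sym (x≐y i)

  ≐-trans : {x y z : Stream A} → x ≐ y → y ≐ z → x ≐ z
  ≐-trans x≐y y≐z i = trans (x≐y i) (y≐z i)

  agree-≤ : ∀ {K K′} {x y : Stream A} → K ≤ K′ → Agree K′ x y → Agree K x y
  agree-≤ K≤K′ agree i i<K = agree i (≤-trans i<K K≤K′)

  tail-shift : ∀ j (x : Stream A) → tail (shift j x) ≐ shift (suc j) x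
  tail-shift j x i = cong x (+-suc j i)

  agree-shift : ∀ {x y : Stream A} j d → Agree (j + d) x y → Agree d (shift j x) (shift j y)
  agree-shift j d agree i i<d = agree (j + i) (+-monoʳ-< j i<d)

  applyUpTo-cong : ∀ {f g : Stream A} n → Agree n f g → applyUpTo f n ≡ applyUpTo g n
  applyUpTo-cong zero _ = refl
  applyUpTo-cong {f} {g} (suc n) agree =
    cong₂ _∷_ (agree 0 (s≤s z≤n))
              (applyUpTo-cong {tail f} {tail g} n (λ i i<n → agree (suc i) (s≤s i<n)))

  applyUpTo-split : ∀ (f : Stream A) {m n} → m < n →
                    Σ (List A) λ r → applyUpTo f n ≡ applyUpTo f m ++ f m ∷ r
  applyUpTo-split f {zero} {suc n} _ = applyUpTo (tail f) n , refl
  applyUpTo-split f {suc m} {suc n} (s≤s m<n) with applyUpTo-split (tail f) m<n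
  ... | r , eq = r , cong (f 0 ∷_) eq

-- The lexicographic order on streams

module StreamOrder {A : Set} (_≺_ : A → A → Set) (irrefl : Irreflexive _≡_ _≺_)
                   (asym : Asymmetric _≺_) where

  infix 4 _<ˡ_ _≤ˡ_

  _<ˡ_ : Stream A → Stream A → Set
  _<ˡ_ = LexLess _≺_

  _≤ˡ_ : Stream A → Stream A → Set
  x ≤ˡ y = x ≐ y ⊎ x <ˡ y

  <ˡ-resp-≐ : ∀ {x y x′ y′} → x <ˡ y → x ≐ x′ → y ≐ y′ → x′ <ˡ y′
  <ˡ-resp-≐ (K , agree , x<y) x≐x′ y≐y′ =
    K , (λ i i<K → trans (sym (x≐x′ i)) (trans (agree i i<K) (y≐y′ i))) ,
    subst₂ _≺_ (x≐x′ K) (y≐y′ K) x<y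

  ≤ˡ-resp-≐ : ∀ {x y x′ y′} → x ≤ˡ y → x ≐ x′ → y ≐ y′ → x′ ≤ˡ y′
  ≤ˡ-resp-≐ (inj₁ x≐y) x≐x′ y≐y′ = inj₁ (≐-trans (≐-sym x≐x′) (≐-trans x≐y y≐y′))
  ≤ˡ-resp-≐ (inj₂ x<y) x≐x′ y≐y′ = inj₂ (<ˡ-resp-≐ x<y x≐x′ y≐y′)

  <ˡ-irrefl : ∀ {x y} → x ≐ y → ¬ (x <ˡ y)
  <ˡ-irrefl x≐y (K , _ , x<y) = irrefl (x≐y K) x<y

  <ˡ-asym : ∀ {x y} → x <ˡ y → ¬ (y <ˡ x)
  <ˡ-asym {x} {y} (K , agree , x<y) (K′ , agree′ , y<x) with <-cmp K K′
  ... | tri< K<K′ _ _ = irrefl (sym (agree′ K K<K′)) x<y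
  ... | tri≈ _ refl _ = asym x<y y<x
  ... | tri> _ _ K′<K = irrefl (sym (agree K′ K′<K)) y<x

  <ˡ⇒≱ˡ : ∀ {x y} → x <ˡ y → ¬ (y ≤ˡ x)
  <ˡ⇒≱ˡ x<y (inj₁ y≐x) = <ˡ-irrefl (≐-sym y≐x) x<y
  <ˡ⇒≱ˡ x<y (inj₂ y<x) = <ˡ-asym x<y y<x

  ≤ˡ-antisym : ∀ {x y} → x ≤ˡ y → y ≤ˡ x → x ≐ y
  ≤ˡ-antisym (inj₁ x≐y) _ = x≐y
  ≤ˡ-antisym (inj₂ x<y) y≤x = ⊥-elim (<ˡ⇒≱ˡ x<y y≤x)

  <ˡ-tail : ∀ {x y} → x 0 ≡ y 0 → x <ˡ y → tail x <ˡ tail y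
  <ˡ-tail x₀≡y₀ (zero , _ , x<y) = ⊥-elim (irrefl x₀≡y₀ x<y)
  <ˡ-tail x₀≡y₀ (suc K , agree , x<y) = K , (λ i i<K → agree (suc i) (s≤s i<K)) , x<y

  ≤ˡ-tail : ∀ {x y} → x 0 ≡ y 0 → x ≤ˡ y → tail x ≤ˡ tail y
  ≤ˡ-tail _ (inj₁ x≐y) = inj₁ (λ i → x≐y (suc i))
  ≤ˡ-tail x₀≡y₀ (inj₂ x<y) = inj₂ (<ˡ-tail x₀≡y₀ x<y)

  <ˡ-cons : ∀ {x y} → x 0 ≡ y 0 → tail x <ˡ tail y → x <ˡ y
  <ˡ-cons x₀≡y₀ (K , agree , x<y) =
    suc K , (λ { zero _ → x₀≡y₀ ; (suc i) (s≤s i<K) → agree i i<K }) , x<y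

  module Transitivity (trans≺ : Transitive _≺_) where

    <ˡ-trans : ∀ {x y z} → x <ˡ y → y <ˡ z → x <ˡ z
    <ˡ-trans {x} {y} {z} (K , agree , x<y) (K′ , agree′ , y<z)
      with <-cmp K K′
    ... | tri< K<K′ _ _ =
      K , (λ i i<K → trans (agree i i<K) (agree′ i (<-trans i<K K<K′))) ,
      subst (x K ≺_) (agree′ K K<K′) x<y
    ... | tri≈ _ refl _ = K , (λ i i<K → trans (agree i i<K) (agree′ i i<K)) , trans≺ x<y y<z
    ... | tri> _ _ K′<K =
      K′ , (λ i i<K′ → trans (agree i (<-trans i<K′ K′<K)) (agree′ i i<K′)) ,
      subst (_≺ z K′) (sym (agree K′ K′<K)) y<z

    <ˡ-≤ˡ-trans : ∀ {x y z} → x <ˡ y → y ≤ˡ z → x <ˡ z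
    <ˡ-≤ˡ-trans x<y (inj₁ y≐z) = <ˡ-resp-≐ x<y ≐-refl y≐z
    <ˡ-≤ˡ-trans x<y (inj₂ y<z) = <ˡ-trans x<y y<z

    ≤ˡ-trans : ∀ {x y z} → x ≤ˡ y → y ≤ˡ z → x ≤ˡ z
    ≤ˡ-trans (inj₁ x≐y) y≤z = ≤ˡ-resp-≐ y≤z (≐-sym x≐y) ≐-refl
    ≤ˡ-trans (inj₂ x<y) y≤z = inj₂ (<ˡ-≤ˡ-trans x<y y≤z)

-- Minima of occurrences in a labelled graph

module Minima {V A : Set} (_≺_ : A → A → Set) (irrefl : Irreflexive _≡_ _≺_)
              (asym : Asymmetric _≺_) (lab : V → A) (Edge : V → V → Set)
              (mn : V → Stream A) (isMin : ∀ x → IsMinAt _≺_ lab Edge x (mn x)) where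

  open StreamOrder _≺_ irrefl asym

  occurrence-tail : ∀ {x β s} → Occurrence lab Edge x β s →
                    Occurrence lab Edge (s 1) (tail β) (tail s)
  occurrence-tail (_ , edges , labels) = refl , (λ i → edges (suc i)) , (λ i → labels (suc i))

  occurrence-cons : ∀ {x y β s} → Edge y x → Occurrence lab Edge y β s →
                    Occurrence lab Edge x (lab x ∷ˢ β) (x ∷ˢ s)
  occurrence-cons {x} {s = s} y→x (s₀≡y , edges , labels) = refl , edges′ , labels′
    where
    edges′ : ∀ i → Edge ((x ∷ˢ s) (suc i)) ((x ∷ˢ s) i)
    edges′ zero = subst (λ z → Edge z x) (sym s₀≡y) y→x
    edges′ (suc i) = edges i
    labels′ : ∀ i → lab ((x ∷ˢ s) i) ≡ (lab x ∷ˢ _) i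
    labels′ zero = refl
    labels′ (suc i) = labels i

  min-head : ∀ x → mn x 0 ≡ lab x
  min-head x with isMin x
  ... | (s , s₀≡x , _ , labels) , _ = trans (sym (labels 0)) (cong lab s₀≡x)

  min-≤ˡ : ∀ {x β} → InI lab Edge x β → mn x ≤ˡ β
  min-≤ˡ {x} {β} β∈I = proj₂ (isMin x) β β∈I

  tail-min-≤ˡ-pred : ∀ {x y} → Edge y x → tail (mn x) ≤ˡ mn y
  tail-min-≤ˡ-pred {x} {y} y→x =
    ≤ˡ-tail (min-head x) (min-≤ˡ (_ , occurrence-cons y→x (proj₂ (proj₁ (isMin y)))))

  min-suffix : ∀ {x β s} → mn x ≐ β → Occurrence lab Edge x β s → mn (s 1) ≐ tail β
  min-suffix {x} mn≐β occ@(s₀≡x , edges , _) =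
    ≤ˡ-antisym (min-≤ˡ (_ , occurrence-tail occ))
               (≤ˡ-resp-≐ (tail-min-≤ˡ-pred (subst (Edge _) s₀≡x (edges 0)))
                          (λ i → mn≐β (suc i)) ≐-refl)

  min-suffixes : ∀ {x β s} → mn x ≐ β → Occurrence lab Edge x β s →
                 ∀ j → mn (s j) ≐ shift j β
  min-suffixes mn≐β (s₀≡x , _) zero = subst (λ z → mn z ≐ _) (sym s₀≡x) mn≐β
  min-suffixes mn≐β occ (suc j) = min-suffixes (min-suffix mn≐β occ) (occurrence-tail occ) j

  min-predecessor : ∀ x → Σ V λ y → Edge y x × mn y ≐ tail (mn x)
  min-predecessor x with isMin x
  ... | (s , occ@(s₀≡x , edges , _)) , _ =
    s 1 , subst (Edge (s 1)) s₀≡x (edges 0) , min-suffix ≐-refl occ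

  -- For the edge y → x of an occurrence of mn x, a difference
  -- e (nxt x) <ˡ e y at a position already treated would give mn (nxt x) <ˡ mn y ≐ tail (mn x),
  -- which the edge nxt x → x forbids.
  min-≐-greedy : (e : V → Stream A) (nxt : V → V) →
    (∀ x → e x 0 ≡ lab x) → (∀ x → Edge (nxt x) x) → (∀ x → tail (e x) ≐ e (nxt x)) →
    (∀ {x y} → Edge y x → e (nxt x) ≤ˡ e y) → ∀ x → mn x ≐ e x
  min-≐-greedy e nxt e-head nxt→ e-tail e-least x i = <-rec P step i x
    where
    P : ℕ → Set
    P i = ∀ x → mn x i ≡ e x i

    step : ∀ i → (∀ {j} → j < i → P j) → P i
    step zero _ x = trans (min-head x) (sym (e-head x))
    step (suc i) ih x = begin
      mn x (suc i)   ≡⟨ sym (mny≐ i) ⟩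
      mn y i         ≡⟨ ih ≤-refl y ⟩
      e y i          ≡⟨ e-greedy (e-least y→x) ⟩
      e (nxt x) i    ≡⟨ sym (e-tail x i) ⟩
      e x (suc i)    ∎
      where
      open ≡-Reasoning
      y = proj₁ (min-predecessor x)
      y→x = proj₁ (proj₂ (min-predecessor x))
      mny≐ = proj₂ (proj₂ (min-predecessor x))

      e-greedy : e (nxt x) ≤ˡ e y → e y i ≡ e (nxt x) i
      e-greedy (inj₁ e≐) = sym (e≐ i)
      e-greedy (inj₂ (m , agree , e<)) with i <? m
      ... | yes i<m = sym (agree i i<m)
      ... | no i≮m = ⊥-elim (<ˡ⇒≱ˡ mn< (≤ˡ-resp-≐ (tail-min-≤ˡ-pred (nxt→ x)) (≐-sym mny≐) ≐-refl))
        where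
        m≤i = ≮⇒≥ i≮m
        mn< : mn (nxt x) <ˡ mn y
        mn< = m , (λ j j<m → let j<1+i = s≤s (≤-trans (<⇒≤ j<m) m≤i) in
                    trans (ih j<1+i (nxt x)) (trans (agree j j<m) (sym (ih j<1+i y)))) ,
              subst₂ _≺_ (sym (ih (s≤s m≤i) (nxt x))) (sym (ih (s≤s m≤i) y)) e<

-- The type τ of a stream over a strict total order

module Types {A : Set} {_≺_ : A → A → Set} (sto : IsStrictTotalOrder _≡_ _≺_) where

  open IsStrictTotalOrder sto using (irrefl; asym; compare) renaming (trans to ≺-trans; _≟_ to _≟ₐ_)
  open StreamOrder _≺_ irrefl asym
  open Transitivity ≺-trans

  τ-resp-≐ : ∀ {x y t} → TauIs _≺_ x t → x ≐ y → TauIs _≺_ y t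
  τ-resp-≐ (tau1 x′<x) x≐y = tau1 (<ˡ-resp-≐ x′<x (λ i → x≐y (suc i)) x≐y)
  τ-resp-≐ (tau2 x′≐x) x≐y = tau2 (λ i → trans (sym (x≐y (suc i))) (trans (x′≐x i) (x≐y i)))
  τ-resp-≐ (tau3 x<x′) x≐y = tau3 (<ˡ-resp-≐ x<x′ x≐y (λ i → x≐y (suc i)))

  τ-unique : ∀ {x t t′} → TauIs _≺_ x t → TauIs _≺_ x t′ → t ≡ t′
  τ-unique (tau1 _) (tau1 _) = refl
  τ-unique (tau2 _) (tau2 _) = refl
  τ-unique (tau3 _) (tau3 _) = refl
  τ-unique (tau1 x′<x) (tau2 x′≐x) = ⊥-elim (<ˡ-irrefl x′≐x x′<x)
  τ-unique (tau1 x′<x) (tau3 x<x′) = ⊥-elim (<ˡ-asym x′<x x<x′)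
  τ-unique (tau2 x′≐x) (tau1 x′<x) = ⊥-elim (<ˡ-irrefl x′≐x x′<x)
  τ-unique (tau2 x′≐x) (tau3 x<x′) = ⊥-elim (<ˡ-irrefl (≐-sym x′≐x) x<x′)
  τ-unique (tau3 x<x′) (tau1 x′<x) = ⊥-elim (<ˡ-asym x′<x x<x′)
  τ-unique (tau3 x<x′) (tau2 x′≐x) = ⊥-elim (<ˡ-irrefl (≐-sym x′≐x) x<x′)

  τ-functional : ∀ {x y t t′} → x ≐ y → TauIs _≺_ x t → TauIs _≺_ y t′ → t ≡ t′
  τ-functional x≐y τx τy = τ-unique (τ-resp-≐ τx x≐y) τy

  τ≥1 : ∀ {x t} → TauIs _≺_ x t → 1 ≤ t
  τ≥1 (tau1 _) = s≤s z≤n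
  τ≥1 (tau2 _) = s≤s z≤n
  τ≥1 (tau3 _) = s≤s z≤n

  τ≤3 : ∀ {x t} → TauIs _≺_ x t → t ≤ 3
  τ≤3 (tau1 _) = s≤s z≤n
  τ≤3 (tau2 _) = s≤s (s≤s z≤n)
  τ≤3 (tau3 _) = s≤s (s≤s (s≤s z≤n))

  τ2-const : ∀ {x} → TauIs _≺_ x 2 → ∀ i → x i ≡ x 0
  τ2-const (tau2 x′≐x) zero = refl
  τ2-const (tau2 x′≐x) (suc i) = trans (x′≐x i) (τ2-const (tau2 x′≐x) i)

  τ2-≐ : ∀ {x y} → x 0 ≡ y 0 → TauIs _≺_ x 2 → TauIs _≺_ y 2 → x ≐ y
  τ2-≐ x₀≡y₀ τx τy i = trans (τ2-const τx i) (trans x₀≡y₀ (sym (τ2-const τy i)))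

  τ<2 : ∀ {x t} → TauIs _≺_ x t → t < 2 → TauIs _≺_ x 1
  τ<2 (tau1 x′<x) _ = tau1 x′<x
  τ<2 (tau2 _) (s≤s (s≤s ()))
  τ<2 (tau3 _) (s≤s (s≤s ()))

  τ≥2 : ∀ {x t} → TauIs _≺_ x t → 2 ≤ t → t ≡ 2 ⊎ t ≡ 3
  τ≥2 (tau1 _) (s≤s ())
  τ≥2 (tau2 _) _ = inj₁ refl
  τ≥2 (tau3 _) _ = inj₂ refl

  Run : Stream A → ℕ → Set
  Run x m = ∀ i → i ≤ m → x i ≡ x 0

  run-agree : ∀ {x y} m → Run x m → Agree (suc m) x y → Run y m
  run-agree m run agree i i≤m =
    trans (sym (agree i (s≤s i≤m))) (trans (run i i≤m) (agree 0 (s≤s z≤n)))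

  run-shift : ∀ {x} j d → Run x (j + d) → Run (shift j x) d
  run-shift j d run i i≤d =
    trans (run (j + i) (+-monoʳ-≤ j i≤d)) (sym (run (j + 0) (+-monoʳ-≤ j z≤n)))

  τ≡1 : ∀ {x} m → Run x m → x (suc m) ≺ x 0 → TauIs _≺_ x 1
  τ≡1 {x} m run drop =
    tau1 (m , (λ i i<m → trans (run (suc i) i<m) (sym (run i (<⇒≤ i<m)))) ,
          subst (x (suc m) ≺_) (sym (run m ≤-refl)) drop)

  τ≡3 : ∀ {x} m → Run x m → x 0 ≺ x (suc m) → TauIs _≺_ x 3
  τ≡3 {x} m run rise =
    tau3 (m , (λ i i<m → trans (run i (<⇒≤ i<m)) (sym (run (suc i) i<m))) ,
          subst (_≺ x (suc m)) (sym (run m ≤-refl)) rise)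

  τ1-drop : ∀ {x} → TauIs _≺_ x 1 → ∃[ m ] (Run x m × x (suc m) ≺ x 0)
  τ1-drop {x} (tau1 (m , agree , drop)) = m , run , subst (x (suc m) ≺_) (run m ≤-refl) drop
    where
    run : Run x m
    run zero _ = refl
    run (suc i) i<m = trans (agree i i<m) (run i (<⇒≤ i<m))

  τ1-shift : ∀ {x} j d → Run x (j + d) → x (suc (j + d)) ≺ x 0 → TauIs _≺_ (shift j x) 1
  τ1-shift {x} j d run drop =
    τ≡1 d (run-shift j d run)
        (subst₂ _≺_ (cong x (sym (+-suc j d))) (sym (run (j + 0) (+-monoʳ-≤ j z≤n))) drop)

  run-or-change : ∀ x K → Run x K ⊎ ∃[ m ] (m < K × Run x m × x (suc m) ≢ x 0)
  run-or-change x zero = inj₁ λ { zero _ → refl }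
  run-or-change x (suc K) with run-or-change x K
  ... | inj₂ (m , m<K , run , change) = inj₂ (m , m<n⇒m<1+n m<K , run , change)
  ... | inj₁ run with x (suc K) ≟ₐ x 0
  ...   | no change = inj₂ (K , ≤-refl , run , change)
  ...   | yes same = inj₁ run′
    where
    run′ : Run x (suc K)
    run′ i i≤1+K with m≤n⇒m<n∨m≡n i≤1+K
    ... | inj₁ i<1+K = run i (≤-pred i<1+K)
    ... | inj₂ refl = same

  τ-by-change : ∀ {x y t t′} m → Run x m → x (suc m) ≢ x 0 → Agree (suc (suc m)) x y →
                TauIs _≺_ x t → TauIs _≺_ y t′ → t ≡ t′
  τ-by-change {x} {y} {t} {t′} m run change agree τx τy = at-change (compare (x (suc m)) (x 0))
    where
    runʸ : Run y m
    runʸ = run-agree m run (agree-≤ (n≤1+n _) agree)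

    at-change : Tri (x (suc m) ≺ x 0) (x (suc m) ≡ x 0) (x 0 ≺ x (suc m)) → t ≡ t′
    at-change (tri≈ _ same _) = ⊥-elim (change same)
    at-change (tri< drop _ _) =
      trans (τ-unique τx (τ≡1 m run drop))
            (τ-unique (τ≡1 m runʸ (subst₂ _≺_ (agree (suc m) ≤-refl) (agree 0 (s≤s z≤n)) drop)) τy)
    at-change (tri> _ _ rise) =
      trans (τ-unique τx (τ≡3 m run rise))
            (τ-unique (τ≡3 m runʸ (subst₂ _≺_ (agree 0 (s≤s z≤n)) (agree (suc m) ≤-refl) rise)) τy)

  τ-mono : ∀ {x y t t′} → x 0 ≡ y 0 → x ≤ˡ y → TauIs _≺_ x t → TauIs _≺_ y t′ → t ≤ t′
  τ-mono _ (inj₁ x≐y) τx τy = ≤-reflexive (τ-functional x≐y τx τy)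
  τ-mono x₀≡y₀ (inj₂ (zero , _ , x₀<y₀)) _ _ = ⊥-elim (irrefl x₀≡y₀ x₀<y₀)
  τ-mono {x} {y} {t} {t′} x₀≡y₀ (inj₂ (suc m , agree , x<y)) τx τy with run-or-change x m
  ... | inj₂ (m′ , m′<m , run , change) =
    ≤-reflexive (τ-by-change m′ run change (agree-≤ (s≤s m′<m) agree) τx τy)
  ... | inj₁ run = after-run (compare (x (suc m)) (x 0))
    where
    y-rises : y 0 ≺ y (suc m) → t ≤ t′
    y-rises rise = ≤-trans (τ≤3 τx) (≤-reflexive (τ-unique (τ≡3 m (run-agree m run agree) rise) τy))

    after-run : Tri (x (suc m) ≺ x 0) (x (suc m) ≡ x 0) (x 0 ≺ x (suc m)) → t ≤ t′
    after-run (tri< drop _ _) = ≤-trans (≤-reflexive (τ-unique τx (τ≡1 m run drop))) (τ≥1 τy)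
    after-run (tri≈ _ same _) = y-rises (subst (_≺ y (suc m)) (trans same x₀≡y₀) x<y)
    after-run (tri> _ _ rise) = y-rises (subst (_≺ y (suc m)) x₀≡y₀ (≺-trans rise x<y))

  -- For the minimum α = min_u of a node u with τ(u) = 3, the paper's γ_u is α[0 .. a] with
  -- a = ℓ_u − 1, and t_u is the type t of the suffix of α starting at a.
  record BlockEnd (α : Stream A) (a t : ℕ) : Set where
    field
      positive    : 1 ≤ a
      descending  : ∀ j → 1 ≤ j → j < a → TauIs _≺_ (shift j α) 1
      type        : TauIs _≺_ (shift a α) t
      non-descent : 2 ≤ t

  open BlockEnd

  end-¬descending : ∀ {α a t y} → BlockEnd α a t → shift a α ≐ y → ¬ TauIs _≺_ y 1
  end-¬descending Eα α≐y τy =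
    <-irrefl refl (subst (2 ≤_) (τ-functional α≐y (type Eα) τy) (non-descent Eα))

  block-not-longer : ∀ {α β b c t t′} → BlockEnd α (suc b + c) t → BlockEnd β b t′ →
                     Agree (suc (suc b + c)) α β → ⊥
  block-not-longer {α} {β} {b} {c} Eα Eβ agree
    with τ1-drop (descending Eα b (positive Eβ) (s≤s (m≤m+n b c)))
  ... | m , run , drop with m <? suc c
  ...   | yes m<1+c = end-¬descending Eβ ≐-refl
                        (τ≡1 m (run-agree m run (agree-≤ (n≤1+n _) agreeₘ))
                             (subst₂ _≺_ (agreeₘ (suc m) ≤-refl) (agreeₘ 0 (s≤s z≤n)) drop))
    where
    agreeₘ : Agree (suc (suc m)) (shift b α) (shift b β)
    agreeₘ i i<2+m = agree (b + i) (s≤s (≤-trans (+-monoʳ-≤ b (≤-trans (≤-pred i<2+m) m<1+c))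
                                                  (≤-reflexive (+-suc b c))))
  ...   | no m≮1+c with m≤n⇒∃[o]m+o≡n (≮⇒≥ m≮1+c)
  ...     | d , refl = end-¬descending Eα shifts (τ1-shift (suc c) d run drop)
    where
    shifts : shift (suc b + c) α ≐ shift (suc c) (shift b α)
    shifts i = cong α (trans (cong suc (+-assoc b c i)) (sym (+-suc b (c + i))))

  blockEnd-unique : ∀ {α β a b t t′} → BlockEnd α a t → BlockEnd β b t′ →
                    Agree (suc a) α β → shift a α ≤ˡ shift a β → a ≡ b
  blockEnd-unique {α} {β} {a} {b} Eα Eβ agree α≤β with <-cmp a b
  ... | tri≈ _ a≡b _ = a≡b
  ... | tri< a<b _ _ =
    ⊥-elim (<-irrefl refl (≤-trans (non-descent Eα)
      (τ-mono (agree (a + 0) (s≤s (≤-reflexive (+-identityʳ a)))) α≤β (type Eα)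
              (descending Eβ a (positive Eα) a<b))))
  ... | tri> _ _ b<a with m≤n⇒∃[o]m+o≡n b<a
  ...   | c , refl = ⊥-elim (block-not-longer Eα Eβ agree)

-- The alphabet Σ′ of the derived graph

module _ {k : ℕ} where

  Diverge : List (Fin k) → List (Fin k) → Set
  Diverge α β =
    Σ (List (Fin k)) λ p → Σ (Fin k) λ c → Σ (Fin k) λ d → Σ (List (Fin k)) λ r₁ →
    Σ (List (Fin k)) λ r₂ → (α ≡ p ++ (c ∷ r₁)) × (β ≡ p ++ (d ∷ r₂)) × (c <ᶠ d)

  diverge-¬extension : ∀ {α β} → Diverge α β → ∀ g h → α ++ g ≢ β ++ h
  diverge-¬extension (p , c , d , r₁ , r₂ , refl , refl , c<d) g h eq =
    Fin.<-irrefl (∷-injectiveˡ (++-cancelˡ p _ _ (begin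
      p ++ (c ∷ r₁ ++ g)    ≡⟨ sym (++-assoc p (c ∷ r₁) g) ⟩
      (p ++ c ∷ r₁) ++ g    ≡⟨ eq ⟩
      (p ++ d ∷ r₂) ++ h    ≡⟨ ++-assoc p (d ∷ r₂) h ⟩
      p ++ (d ∷ r₂ ++ h)    ∎))) c<d
    where open ≡-Reasoning

  diverge⇒≢ : ∀ {α β} → Diverge α β → α ≢ β
  diverge⇒≢ {α} {β} div α≡β =
    diverge-¬extension div [] [] (trans (++-identityʳ α) (trans α≡β (sym (++-identityʳ β))))

  diverge⇒¬prefix : ∀ {α β} → Diverge α β → ¬ Prefix α β
  diverge⇒¬prefix {β = β} div (g , α++g≡β) =
    diverge-¬extension div g [] (trans α++g≡β (sym (++-identityʳ β)))

  diverge-asym : ∀ {α β} → Diverge α β → Diverge β α → ⊥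
  diverge-asym (p , c , d , r₁ , r₂ , α≡ , β≡ , c<d)
               (p′ , c′ , d′ , r₁′ , r₂′ , β≡′ , α≡′ , c′<d′) =
    go p p′ (trans (sym α≡) α≡′) (trans (sym β≡) β≡′) c<d c′<d′
    where
    go : ∀ p p′ {c d c′ d′ r₁ r₂ r₁′ r₂′} → p ++ c ∷ r₁ ≡ p′ ++ d′ ∷ r₂′ →
         p ++ d ∷ r₂ ≡ p′ ++ c′ ∷ r₁′ → c <ᶠ d → c′ <ᶠ d′ → ⊥
    go [] [] refl refl c<d c′<d′ = Fin.<-asym c<d c′<d′
    go [] (_ ∷ _) refl refl c<d _ = Fin.<-irrefl refl c<d
    go (_ ∷ _) [] refl refl _ c′<d′ = Fin.<-irrefl refl c′<d′
    go (_ ∷ p) (_ ∷ p′) eq eq′ = go p p′ (∷-injectiveʳ eq) (∷-injectiveʳ eq′)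

  strictPrefix⇒prefix : ∀ {α β : List (Fin k)} → StrictPrefix α β → Prefix α β
  strictPrefix⇒prefix (g , _ , α++g≡β) = g , α++g≡β

  strictPrefix⇒length< : ∀ {α β : List (Fin k)} → StrictPrefix α β → length α < length β
  strictPrefix⇒length< ([] , g≢[] , _) = ⊥-elim (g≢[] refl)
  strictPrefix⇒length< {α} (x ∷ g , _ , refl) = begin-strict
    length α                  <⟨ m<m+n (length α) (s≤s z≤n) ⟩
    length α + length (x ∷ g) ≡⟨ sym (length-++ α) ⟩
    length (α ++ x ∷ g)       ∎
    where open ≤-Reasoning

  prefixes-diverge : ∀ {α β : Stream (Fin k)} {K m m′} → Agree K α β → α K <ᶠ β K →
                     K < m → K < m′ → Diverge (applyUpTo α m) (applyUpTo β m′)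
  prefixes-diverge {α} {β} {K} agree αK<βK K<m K<m′
    with applyUpTo-split α K<m | applyUpTo-split β K<m′
  ... | r₁ , α≡ | r₂ , β≡ =
    applyUpTo α K , α K , β K , r₁ , r₂ , α≡ ,
    trans β≡ (cong (_++ β K ∷ r₂) (sym (applyUpTo-cong K agree))) , αK<βK

  prefix-strict : ∀ {α β : Stream (Fin k)} {m m′} → Agree m′ α β → m′ < m →
                  StrictPrefix (applyUpTo β m′) (applyUpTo α m)
  prefix-strict {α} {m′ = m′} agree m′<m with applyUpTo-split α m′<m
  ... | r , α≡ =
    α m′ ∷ r , (λ ()) , trans (cong (_++ α m′ ∷ r) (sym (applyUpTo-cong m′ agree))) (sym α≡)

  ≺′-shape : ∀ {α β x y} → (α , x) ≺' (β , y) →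
             Diverge α β ⊎ (α ≡ β × x ≡ 2 × y ≡ 3) ⊎ StrictPrefix β α
  ≺′-shape (_ , inj₁ (¬prefix , inj₁ sp)) = ⊥-elim (¬prefix (strictPrefix⇒prefix sp))
  ≺′-shape (_ , inj₁ (_ , inj₂ div)) = inj₁ div
  ≺′-shape (_ , inj₂ rest) = inj₂ rest

  ≺′-irrefl : Irreflexive _≡_ (_≺'_ {k})
  ≺′-irrefl eq (neq , _) = neq eq

  ≺′-asym : Asymmetric (_≺'_ {k})
  ≺′-asym p q = shapes-asym (≺′-shape p) (≺′-shape q)
    where
    shapes-asym : ∀ {α β x y} →
      Diverge α β ⊎ (α ≡ β × x ≡ 2 × y ≡ 3) ⊎ StrictPrefix β α →
      Diverge β α ⊎ (β ≡ α × y ≡ 2 × x ≡ 3) ⊎ StrictPrefix α β → ⊥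
    shapes-asym (inj₁ div) (inj₁ div′) = diverge-asym div div′
    shapes-asym (inj₁ div) (inj₂ (inj₁ (β≡α , _))) = diverge⇒≢ div (sym β≡α)
    shapes-asym (inj₁ div) (inj₂ (inj₂ sp)) = diverge⇒¬prefix div (strictPrefix⇒prefix sp)
    shapes-asym (inj₂ (inj₁ (α≡β , _))) (inj₁ div′) = diverge⇒≢ div′ (sym α≡β)
    shapes-asym (inj₂ (inj₁ (_ , x≡2 , _))) (inj₂ (inj₁ (_ , _ , x≡3))) with trans (sym x≡2) x≡3
    ... | ()
    shapes-asym (inj₂ (inj₁ (refl , _))) (inj₂ (inj₂ sp)) = <-irrefl refl (strictPrefix⇒length< sp)
    shapes-asym (inj₂ (inj₂ sp)) (inj₁ div′) = diverge⇒¬prefix div′ (strictPrefix⇒prefix sp)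
    shapes-asym (inj₂ (inj₂ sp)) (inj₂ (inj₁ (refl , _))) = <-irrefl refl (strictPrefix⇒length< sp)
    shapes-asym (inj₂ (inj₂ sp)) (inj₂ (inj₂ sp′)) =
      <-asym (strictPrefix⇒length< sp) (strictPrefix⇒length< sp′)

  ≺′-diverge : ∀ {α β x y} → Diverge α β → (α , x) ≺' (β , y)
  ≺′-diverge div = (λ eq → diverge⇒≢ div (cong proj₁ eq)) , inj₁ (diverge⇒¬prefix div , inj₂ div)

  ≺′-strictPrefix : ∀ {α β x y} → StrictPrefix β α → (α , x) ≺' (β , y)
  ≺′-strictPrefix sp =
    (λ eq → <-irrefl (cong length (sym (cong proj₁ eq))) (strictPrefix⇒length< sp)) , inj₂ (inj₂ sp)

  ≺′-2-3 : ∀ {α : List (Fin k)} → (α , 2) ≺' (α , 3)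
  ≺′-2-3 = (λ ()) , inj₂ (inj₁ (refl , refl , refl))

-- The derived graph

3≢2 : 3 ≢ 2
3≢2 ()

module DerivedGraph {n k : ℕ} {lab : Fin n → Fin k} {E : Fin n → Fin n → Set}
  {mn : Fin n → Stream (Fin k)} (isMin : ∀ u → IsMinAt _<ᶠ_ lab E u (mn u))
  {τf : Fin n → ℕ} (isτ : ∀ u → TauIs _<ᶠ_ (mn u) (τf u))
  {ℓ : Fin n → ℕ} (isℓ : ∀ u → τf u ≡ 3 → Construction.EllSpec lab E τf mn u (ℓ u))
  {tt : Fin n → ℕ} (isT : ∀ u → τf u ≡ 3 → Construction.TSpec lab E τf ℓ u (tt u)) where

  open Construction lab E τf
  open Derived mn ℓ tt
  open StreamOrder (_<ᶠ_ {k}) Fin.<-irrefl Fin.<-asym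
  open Transitivity Fin.<-trans
  open Minima (_<ᶠ_ {k}) Fin.<-irrefl Fin.<-asym lab E mn isMin
  open Types (Fin.<-isStrictTotalOrder {k})

  ≤ˡ-head : ∀ {x y : Stream (Fin k)} → x ≤ˡ y → x 0 ≤ᶠ y 0
  ≤ˡ-head (inj₁ x≐y) = Fin.≤-reflexive (x≐y 0)
  ≤ˡ-head (inj₂ (zero , _ , x₀<y₀)) = <⇒≤ x₀<y₀
  ≤ˡ-head (inj₂ (suc _ , agree , _)) = Fin.≤-reflexive (agree 0 (s≤s z≤n))

  μ : V̄ → Stream (Fin k)
  μ x = mn (proj₁ x)

  module Node (x : V̄) where

    u : Fin n
    u = proj₁ x

    α : Stream (Fin k)
    α = μ x

    a : ℕ
    a = ℓ u ∸ 1

    spec : EllSpec mn u (ℓ u)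
    spec = isℓ u (proj₂ x)

    s : ℕ → Fin n
    s = proj₁ spec

    ℓ≡1+a : ℓ u ≡ suc a
    ℓ≡1+a = sym (m+[n∸m]≡n (≤-trans (s≤s z≤n) (proj₁ (proj₂ (proj₂ spec)))))

    τ-along : ∀ j → TauIs _<ᶠ_ (shift j α) (τf (s j))
    τ-along j = τ-resp-≐ (isτ (s j)) (min-suffixes ≐-refl (proj₁ (proj₂ spec)) j)

    descending : ∀ j → 1 ≤ j → j < a → TauIs _<ᶠ_ (shift j α) 1
    descending j 1≤j j<a =
      τ<2 (τ-along j) (proj₂ (proj₂ (proj₂ (proj₂ spec))) (suc j) (s≤s 1≤j)
                                                          (subst (suc j <_) (sym ℓ≡1+a) (s≤s j<a)))

    -- The nodes of G_{p+1}(u) spell strings above the suffix α[p..], and one of them attains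
    -- it.  That node is new at step p + 1 because the suffixes α[1..], …, α[a − 1..] descend.
    record Level (p : ℕ) : Set where
      field
        label    : ∀ {w} → Gset u (suc p) w → lab w ≡ shift p α 0
        above    : ∀ {w} → Gset u (suc p) w → shift p α ≤ˡ mn w
        type     : ∀ {w} → Gset u (suc p) w → TauIs _<ᶠ_ (shift p α) (τf w)
        attained : Σ (Fin n) λ q → Gset u (suc p) q × mn q ≐ shift p α
        above-U  : ∀ {w} → Uset u (suc p) w → shift p α ≤ˡ mn w

    level-zero : Level 0
    level-zero = record
      { label = λ { refl → sym (min-head u) }
      ; above = λ { refl → inj₁ ≐-refl }
      ; type = λ { refl → isτ u }
      ; attained = u , refl , ≐-refl
      ; above-U = λ ()
      }

    U-strictly-above : ∀ p → p < a → Level p → ∀ {w} → Uset u (suc p) w → shift (suc p) α <ˡ mn w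
    U-strictly-above (suc p) p<a L w∈U with descending (suc p) (s≤s z≤n) p<a
    ... | tau1 descent =
      <ˡ-≤ˡ-trans (<ˡ-resp-≐ descent (tail-shift (suc p) α) ≐-refl) (Level.above-U L w∈U)

    level-suc : ∀ p → p < a → Level p → Level (suc p)
    level-suc p p<a L = record
      { label = λ { (w∈F , _) → trans (R′-label (proj₁ w∈F)) (trans (sym (min-head q)) (mnq≐ 0)) }
      ; above = λ { (w∈F , _) → pred-above (proj₁ (proj₁ w∈F)) }
      ; type = λ { (w∈F , _) →
          subst (TauIs _<ᶠ_ _) (≤-antisym (τ-least (proj₁ w∈F)) (proj₂ w∈F q q∈R′))
                               (τ-resp-≐ (isτ q) mnq≐) }
      ; attained = q , (q∈F , q∉U) , mnq≐
      ; above-U = λ { (inj₁ w∈U) → inj₂ (U-strictly-above p p<a L w∈U)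
                    ; (inj₂ (w∈F , _)) → pred-above (proj₁ (proj₁ w∈F)) }
      }
      where
      R : Fin n → Set
      R = Pred (Gset u (suc p))

      pred-above : ∀ {w} → R w → shift (suc p) α ≤ˡ mn w
      pred-above (v , v∈G , w→v) =
        ≤ˡ-resp-≐ (≤ˡ-trans (≤ˡ-tail (sym (trans (min-head v) (Level.label L v∈G)))
                                     (Level.above L v∈G))
                            (tail-min-≤ˡ-pred w→v))
                  (tail-shift p α) ≐-refl

      v₀ : Fin n
      v₀ = proj₁ (Level.attained L)

      q : Fin n
      q = proj₁ (min-predecessor v₀)

      q∈R : R q
      q∈R = v₀ , proj₁ (proj₂ (Level.attained L)) , proj₁ (proj₂ (min-predecessor v₀))

      mnq≐ : mn q ≐ shift (suc p) α
      mnq≐ = ≐-trans (proj₂ (proj₂ (min-predecessor v₀)))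
                     (≐-trans (λ i → proj₂ (proj₂ (Level.attained L)) (suc i)) (tail-shift p α))

      q-below : ∀ {w} → R w → mn q ≤ˡ mn w
      q-below w∈R = ≤ˡ-resp-≐ (pred-above w∈R) (≐-sym mnq≐) ≐-refl

      q∈R′ : InR' R q
      q∈R′ = q∈R , λ w w∈R → subst₂ _≤ᶠ_ (min-head q) (min-head w) (≤ˡ-head (q-below w∈R))

      R′-label : ∀ {w} → InR' R w → lab w ≡ lab q
      R′-label {w} (w∈R , w-least) = Fin.≤-antisym (w-least q q∈R) (proj₂ q∈R′ w w∈R)

      τ-least : ∀ {w} → InR' R w → τf q ≤ τf w
      τ-least {w} w∈R′@(w∈R , _) =
        τ-mono (trans (min-head q) (trans (sym (R′-label w∈R′)) (sym (min-head w))))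
               (q-below w∈R) (isτ q) (isτ w)

      q∈F : F R q
      q∈F = q∈R′ , λ w w∈R′ → τ-least w∈R′

      q∉U : ¬ Uset u (suc p) q
      q∉U q∈U = <ˡ-irrefl (≐-sym mnq≐) (U-strictly-above p p<a L q∈U)

    level : ∀ p → p ≤ a → Level p
    level zero _ = level-zero
    level (suc p) p<a = level-suc p p<a (level p (<⇒≤ p<a))

    top : Level a
    top = level a ≤-refl

    Gℓ⇒Gtop : ∀ {w} → Gset u (ℓ u) w → Gset u (suc a) w
    Gℓ⇒Gtop {w} = subst (λ L → Gset u L w) ℓ≡1+a

    successor : Fin n
    successor = proj₁ (Level.attained top)

    successor∈G : Gset u (ℓ u) successor
    successor∈G = subst (λ L → Gset u L successor) (sym ℓ≡1+a) (proj₁ (proj₂ (Level.attained top)))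

    min-successor : mn successor ≐ shift a α
    min-successor = proj₂ (proj₂ (Level.attained top))

    G-above : ∀ {w} → Gset u (ℓ u) w → shift a α ≤ˡ mn w
    G-above w∈G = Level.above top (Gℓ⇒Gtop w∈G)

    type : TauIs _<ᶠ_ (shift a α) (tt u)
    type = subst (TauIs _<ᶠ_ (shift a α)) (proj₂ (proj₂ (isT u (proj₂ x))))
                 (Level.type top (Gℓ⇒Gtop (proj₁ (proj₂ (isT u (proj₂ x))))))

    blockEnd : BlockEnd α a (tt u)
    blockEnd = record
      { positive = ≤-pred (subst (2 ≤_) ℓ≡1+a (proj₁ (proj₂ (proj₂ spec))))
      ; descending = descending
      ; type = type
      ; non-descent = subst (2 ≤_) (τ-unique (τ-along a) type) (proj₁ (proj₂ (proj₂ (proj₂ spec))))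
      }

    τ-successor : τf successor ≡ tt u
    τ-successor = τ-unique (Level.type top (proj₁ (proj₂ (Level.attained top)))) type

    γ≡ : γ u ≡ applyUpTo α (suc a)
    γ≡ = trans (cong (λ L → map α (upTo L)) ℓ≡1+a) (map-upTo α (suc a))

  end : V̄ → ℕ
  end = Node.a

  next : V̄ → V̄
  next x with tt (proj₁ x) ≟ 3
  ... | yes t≡3 = Node.successor x , trans (Node.τ-successor x) t≡3
  ... | no _ = x

  path : V̄ → ℕ → V̄
  path x zero = x
  path x (suc i) = path (next x) i

  ē : V̄ → Stream (Σ' k)
  ē x i = lab̄ (path x i)

  next-cases : ∀ x → (tt (proj₁ x) ≡ 3 × μ (next x) ≐ shift (end x) (μ x)
                                      × Gset (proj₁ x) (ℓ (proj₁ x)) (proj₁ (next x)))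
                   ⊎ (tt (proj₁ x) ≡ 2 × next x ≡ x)
  next-cases x with tt (proj₁ x) ≟ 3
  ... | yes t≡3 = inj₁ (t≡3 , Node.min-successor x , Node.successor∈G x)
  ... | no t≢3 with τ≥2 (Node.type x) (BlockEnd.non-descent (Node.blockEnd x))
  ...   | inj₁ t≡2 = inj₂ (t≡2 , refl)
  ...   | inj₂ t≡3 = ⊥-elim (t≢3 t≡3)

  next-min : ∀ x → tt (proj₁ x) ≡ 3 → μ (next x) ≐ shift (end x) (μ x)
  next-min x t≡3 with next-cases x
  ... | inj₁ (_ , next≐ , _) = next≐
  ... | inj₂ (t≡2 , _) = ⊥-elim (3≢2 (trans (sym t≡3) t≡2))

  next-edge : ∀ x → Ē (next x) x
  next-edge x with next-cases x
  ... | inj₁ (t≡3 , _ , next∈G) = inj₂ (t≡3 , next∈G)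
  ... | inj₂ (t≡2 , next≡x) = subst (λ z → Ē z x) (sym next≡x) (inj₁ (t≡2 , refl))

  γ-≡ : ∀ x y → Agree (suc (end x)) (μ x) (μ y) → end x ≡ end y → γ (proj₁ x) ≡ γ (proj₁ y)
  γ-≡ x y agree ends≡ = begin
    γ (proj₁ x)                     ≡⟨ Node.γ≡ x ⟩
    applyUpTo (μ x) (suc (end x))   ≡⟨ applyUpTo-cong (suc (end x)) agree ⟩
    applyUpTo (μ y) (suc (end x))   ≡⟨ cong (λ j → applyUpTo (μ y) (suc j)) ends≡ ⟩
    applyUpTo (μ y) (suc (end y))   ≡⟨ sym (Node.γ≡ y) ⟩
    γ (proj₁ y)                     ∎
    where open ≡-Reasoning

  module Ḡ = StreamOrder (_≺'_ {k}) ≺′-irrefl ≺′-asym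

  module _ (x y : V̄) (μx≐μy : μ x ≐ μ y) where

    end-≡ : end x ≡ end y
    end-≡ = blockEnd-unique (Node.blockEnd x) (Node.blockEnd y) (λ i _ → μx≐μy i)
                            (inj₁ (λ i → μx≐μy (end x + i)))

    shift-end-≐ : shift (end x) (μ x) ≐ shift (end y) (μ y)
    shift-end-≐ i = trans (μx≐μy (end x + i)) (cong (λ j → μ y (j + i)) end-≡)

    tt-≡ : tt (proj₁ x) ≡ tt (proj₁ y)
    tt-≡ = τ-functional shift-end-≐ (Node.type x) (Node.type y)

    next-≐ : μ (next x) ≐ μ (next y)
    next-≐ with next-cases x | next-cases y
    ... | inj₁ (_ , next-x≐ , _) | inj₁ (_ , next-y≐ , _) =
      ≐-trans next-x≐ (≐-trans shift-end-≐ (≐-sym next-y≐))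
    ... | inj₂ (_ , next-x≡x) | inj₂ (_ , next-y≡y) =
      subst₂ (λ x′ y′ → μ x′ ≐ μ y′) (sym next-x≡x) (sym next-y≡y) μx≐μy
    ... | inj₁ (t≡3 , _) | inj₂ (t′≡2 , _) = ⊥-elim (3≢2 (trans (sym t≡3) (trans tt-≡ t′≡2)))
    ... | inj₂ (t≡2 , _) | inj₁ (t′≡3 , _) = ⊥-elim (3≢2 (trans (sym t′≡3) (trans (sym tt-≡) t≡2)))

  ē-≐ : ∀ x y → μ x ≐ μ y → ē x ≐ ē y
  ē-≐ x y μx≐μy zero = cong₂ _,_ (γ-≡ x y (λ i _ → μx≐μy i) (end-≡ x y μx≐μy)) (tt-≡ x y μx≐μy)
  ē-≐ x y μx≐μy (suc i) = ē-≐ (next x) (next y) (next-≐ x y μx≐μy) i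

  lab̄-< : ∀ x y {K} → K ≤ end x → Agree K (μ x) (μ y) → μ x K <ᶠ μ y K → lab̄ x ≺' lab̄ y
  lab̄-< x y {K} K≤a agree lt with end y <? K
  ... | yes b<K =
    ≺′-strictPrefix (subst₂ StrictPrefix (sym (Node.γ≡ y)) (sym (Node.γ≡ x))
                      (prefix-strict (agree-≤ b<K agree) (s≤s (<-≤-trans b<K K≤a))))
  ... | no b≮K =
    ≺′-diverge (subst₂ Diverge (sym (Node.γ≡ x)) (sym (Node.γ≡ y))
                 (prefixes-diverge agree lt (s≤s K≤a) (s≤s (≮⇒≥ b≮K))))

  -- Induction on the first difference K: when it lies beyond the first block, the blocks and
  -- the types t coincide or are ordered, and the comparison moves to the successors at K − a.
  ē-< : ∀ K x y → Agree K (μ x) (μ y) → μ x K <ᶠ μ y K → ē x Ḡ.<ˡ ē y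
  ē-< = <-rec P step
    where
    P : ℕ → Set
    P K = ∀ x y → Agree K (μ x) (μ y) → μ x K <ᶠ μ y K → ē x Ḡ.<ˡ ē y

    step : ∀ K → (∀ {K′} → K′ < K → P K′) → P K
    step K rec x y agree lt with end x <? K
    ... | no a≮K = 0 , (λ _ ()) , lab̄-< x y (≮⇒≥ a≮K) agree lt
    ... | yes a<K with m≤n⇒∃[o]m+o≡n (<⇒≤ a<K)
    ...   | zero , refl = ⊥-elim (<-irrefl (sym (+-identityʳ (end x))) a<K)
    ...   | suc d , refl =
      same-block (τ≥2 (Node.type x) (BlockEnd.non-descent Ex)) (τ≥2 typeʸ (BlockEnd.non-descent Ey))
      where
      a : ℕ
      a = end x
      Ex : BlockEnd (μ x) a (tt (proj₁ x))
      Ex = Node.blockEnd x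
      Ey : BlockEnd (μ y) (end y) (tt (proj₁ y))
      Ey = Node.blockEnd y

      shifted : shift a (μ x) <ˡ shift a (μ y)
      shifted = suc d , agree-shift a (suc d) agree , lt

      a≡b : a ≡ end y
      a≡b = blockEnd-unique Ex Ey (agree-≤ a<K agree) (inj₂ shifted)

      typeʸ : TauIs _<ᶠ_ (shift a (μ y)) (tt (proj₁ y))
      typeʸ = subst (λ j → TauIs _<ᶠ_ (shift j (μ y)) (tt (proj₁ y))) (sym a≡b) (Node.type y)

      heads : shift a (μ x) 0 ≡ shift a (μ y) 0
      heads = agree-shift a (suc d) agree 0 (s≤s z≤n)

      blocks : γ (proj₁ x) ≡ γ (proj₁ y)
      blocks = γ-≡ x y (agree-≤ a<K agree) a≡b

      same-block : tt (proj₁ x) ≡ 2 ⊎ tt (proj₁ x) ≡ 3 → tt (proj₁ y) ≡ 2 ⊎ tt (proj₁ y) ≡ 3 →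
                   ē x Ḡ.<ˡ ē y
      same-block (inj₁ t≡2) (inj₁ t′≡2) =
        ⊥-elim (<ˡ-irrefl (τ2-≐ heads (subst (TauIs _ _) t≡2 (Node.type x))
                                      (subst (TauIs _ _) t′≡2 typeʸ))
                          shifted)
      same-block (inj₁ t≡2) (inj₂ t′≡3) =
        0 , (λ _ ()) , subst₂ _≺'_ (cong₂ _,_ refl (sym t≡2)) (cong₂ _,_ blocks (sym t′≡3)) ≺′-2-3
      same-block (inj₂ t≡3) (inj₁ t′≡2) =
        ⊥-elim (<-irrefl refl
                 (subst₂ _≤_ t≡3 t′≡2 (τ-mono heads (inj₂ shifted) (Node.type x) typeʸ)))
      same-block (inj₂ t≡3) (inj₂ t′≡3) =
        Ḡ.<ˡ-cons (cong₂ _,_ blocks (trans t≡3 (sym t′≡3)))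
                  (rec (m<n+m (suc d) (BlockEnd.positive Ex)) (next x) (next y) agree-next lt-next)
        where
        next-x≐ : μ (next x) ≐ shift a (μ x)
        next-x≐ = next-min x t≡3

        next-y≐ : μ (next y) ≐ shift a (μ y)
        next-y≐ = ≐-trans (next-min y t′≡3) (λ i → cong (λ j → μ y (j + i)) (sym a≡b))

        agree-next : Agree (suc d) (μ (next x)) (μ (next y))
        agree-next i i<d =
          trans (next-x≐ i) (trans (agree-shift a (suc d) agree i i<d) (sym (next-y≐ i)))

        lt-next : μ (next x) (suc d) <ᶠ μ (next y) (suc d)
        lt-next = subst₂ _<ᶠ_ (sym (next-x≐ (suc d))) (sym (next-y≐ (suc d))) lt

  ē-mono : ∀ x y → μ x ≤ˡ μ y → ē x Ḡ.≤ˡ ē y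
  ē-mono x y (inj₁ μx≐μy) = inj₁ (ē-≐ x y μx≐μy)
  ē-mono x y (inj₂ (K , agree , lt)) = inj₂ (ē-< K x y agree lt)

  ē-least : ∀ {x y} → Ē y x → ē (next x) Ḡ.≤ˡ ē y
  ē-least {x} {y} (inj₂ (t≡3 , y∈G)) =
    ē-mono (next x) y (≤ˡ-resp-≐ (Node.G-above x y∈G) (≐-sym (next-min x t≡3)) ≐-refl)
  ē-least {v , τv≡3} {.v , τv≡3′} (inj₁ (t≡2 , refl)) with next-cases (v , τv≡3)
  ... | inj₁ (t≡3 , _) = ⊥-elim (3≢2 (trans (sym t≡3) t≡2))
  ... | inj₂ (_ , next≡x) =
    inj₁ (λ i → cong (λ z → ē z i) (trans next≡x (cong (v ,_) (≡-irrelevant τv≡3 τv≡3′))))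

  min̄≐ē : (mnbar : V̄ → Stream (Σ' k)) → (∀ x → IsMinAt _≺'_ lab̄ Ē x (mnbar x)) →
          ∀ x → mnbar x ≐ ē x
  min̄≐ē mnbar isMin̄ =
    Minima.min-≐-greedy _≺'_ ≺′-irrefl ≺′-asym lab̄ Ē mnbar isMin̄
                        ē next (λ _ → refl) next-edge (λ _ → ≐-refl) ē-least

theorem21 : (n k : ℕ) (lab : Fin n → Fin k) (E : Fin n → Fin n → Set) →
    IsGraph n k lab E →
    (mn : Fin n → ℕ → Fin k) → (∀ u → IsMinAt _<ᶠ_ lab E u (mn u)) →
    (τf : Fin n → ℕ) → (∀ u → TauIs _<ᶠ_ (mn u) (τf u)) →
    (ℓ : Fin n → ℕ) → (∀ u → τf u ≡ 3 → Construction.EllSpec lab E τf mn u (ℓ u)) →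
    (tt : Fin n → ℕ) → (∀ u → τf u ≡ 3 → Construction.TSpec lab E τf ℓ u (tt u)) →
    (mnbar : Construction.Derived.V̄ lab E τf mn ℓ tt → ℕ → Σ' k) →
    (∀ ū → IsMinAt _≺'_ (Construction.Derived.lab̄ lab E τf mn ℓ tt)
                        (Construction.Derived.Ē lab E τf mn ℓ tt) ū (mnbar ū)) →
    (u v : Construction.Derived.V̄ lab E τf mn ℓ tt) →
    (StrEq (mn (proj₁ u)) (mn (proj₁ v)) → StrEq (mnbar u) (mnbar v))
    × (LexLess _<ᶠ_ (mn (proj₁ u)) (mn (proj₁ v)) → LexLess _≺'_ (mnbar u) (mnbar v))
theorem21 n k lab E _ mn isMin τf isτ ℓ isℓ tt isT mnbar isMin̄ u v =
  (λ u≐v → ≐-trans (mnbar≐ē u) (≐-trans (ē-≐ u v u≐v) (≐-sym (mnbar≐ē v)))) ,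
  (λ { (K , agree , lt) →
         Ḡ.<ˡ-resp-≐ (ē-< K u v agree lt) (≐-sym (mnbar≐ē u)) (≐-sym (mnbar≐ē v)) })
  where
  open DerivedGraph isMin isτ isℓ isT

  mnbar≐ē : ∀ x → mnbar x ≐ ē x
  mnbar≐ē = min̄≐ē mnbar isMin̄
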